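{- Let $G$ be a finite group. Then $M^*(G)=B_{k^*(G)}$, where $$k^*(G)=\tfrac12\{c(G)+c_2(G)\}-1.$$
   Context: A metric $d$ on $G$ is bi-invariant if $d(gh,g'h)=d(g,g')=d(hg,hg')$ for all $g,g',h\in G$. The induced partition of $d$ is the partition of $G$ into classes of $g\sim h\iff d(g,e)=d(h,e)$, and two metrics are equivalent if they have the same induced partition; $M^*(G)$ is the number of equivalence classes of bi-invariant metrics on $G$. $c(G)$ is the number of conjugacy classes of $G$, and $c_2(G)$ is the number of real conjugacy classes, i.e. classes $C_g=\{hgh^{ -1}:h\in G\}$ with $C_g=C_{g^{ -1}}$. $B_m$ is the $m$-th Bell number.
   Formalization: The bi-invariant metrics counted by $M^*(G)$ take values in the nonnegative rationals instead of the nonnegative reals. -}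

module Defs where

open import Data.Nat using (ℕ; zero; suc; _+_; _*_; _∸_)
open import Data.Nat.DivMod using (_/_)
open import Data.Fin using (Fin)
open import Data.Fin.Properties using (any?)
open import Data.Bool using (Bool)
open import Data.Bool.Properties using () renaming (_≟_ to _≟ᵇ_)
open import Data.Vec using (Vec; tabulate)
open import Data.Vec.Properties using (≡-dec)
open import Data.List using (List; length; map; filter; deduplicate)
open import Data.List.Relation.Unary.Unique.Propositional using (Unique)
open import Data.List.Membership.Propositional using (_∈_)
open import Data.Fin.Properties using () renaming (_≟_ to _≟f_)
open import Data.Rational using (ℚ; 0ℚ; _≤_) renaming (_+_ to _+ℚ_; _≟_ to _≟ℚ_)
open import Data.Product using (Σ; _×_; ∃)
open import Function.Bundles using (_⇔_)
open import Relation.Nullary using (does)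
open import Relation.Binary.PropositionalEquality using (_≡_)
open import Data.List using (allFin)

-- A finite group, presented concretely on the carrier Fin n
-- (every finite group is isomorphic to one of these).
record FinGroup : Set where
  field
    n      : ℕ
    _·_    : Fin n → Fin n → Fin n
    e      : Fin n
    inv    : Fin n → Fin n
    assoc  : ∀ x y z → (x · y) · z ≡ x · (y · z)
    idˡ    : ∀ x → e · x ≡ x
    idʳ    : ∀ x → x · e ≡ x
    invˡ   : ∀ x → inv x · x ≡ e
    invʳ   : ∀ x → x · inv x ≡ e

module _ (G : FinGroup) where
  open FinGroup G

  record IsMetric (d : Fin n → Fin n → ℚ) : Set where
    field
      nonneg   : ∀ x y → 0ℚ ≤ d x y
      zero⇔eq  : ∀ x y → (d x y ≡ 0ℚ) ⇔ (x ≡ y)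
      sym      : ∀ x y → d x y ≡ d y x
      triangle : ∀ x y z → d x z ≤ d x y +ℚ d y z

  record IsBiInvariantMetric (d : Fin n → Fin n → ℚ) : Set where
    field
      metric : IsMetric d
      rightInv : ∀ g g′ h → d (g · h) (g′ · h) ≡ d g g′
      leftInv  : ∀ g g′ h → d (h · g) (h · g′) ≡ d g g′

  -- a partition of G, encoded by its equivalence relation as a Boolean matrix
  Partition : Set
  Partition = Vec (Vec Bool n) n

  inducedPartition : (Fin n → Fin n → ℚ) → Partition
  inducedPartition d = tabulate λ g → tabulate λ h → does (d g e ≟ℚ d h e)

  -- M*(G) = m : there are exactly m distinct induced partitions of
  -- bi-invariant metrics (= number of equivalence classes of such metrics)
  MStarIs : ℕ → Set
  MStarIs m = Σ (List Partition) λ L →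
      Unique L
    × (∀ P → (P ∈ L) ⇔ (∃ λ d → IsBiInvariantMetric d × inducedPartition d ≡ P))
    × length L ≡ m

  conjClass : Fin n → Vec Bool n
  conjClass g = tabulate λ x → does (any? λ h → ((h · g) · inv h) ≟f x)

  conjClasses : List (Vec Bool n)
  conjClasses = deduplicate (≡-dec _≟ᵇ_) (map conjClass (allFin n))

  c : ℕ
  c = length conjClasses

  c₂ : ℕ
  c₂ = length (deduplicate (≡-dec _≟ᵇ_)
         (map conjClass (filter (λ g → ≡-dec _≟ᵇ_ (conjClass g) (conjClass (inv g))) (allFin n))))

  -- k*(G) = (c(G) + c₂(G))/2 - 1   (c + c₂ is always even)
  kStar : ℕ
  kStar = (c + c₂) / 2 ∸ 1

S₂ : ℕ → ℕ → ℕ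
S₂ zero    zero    = 1
S₂ zero    (suc k) = 0
S₂ (suc m) zero    = 0
S₂ (suc m) (suc k) = suc k * S₂ m (suc k) + S₂ m k

bellSum : ℕ → ℕ → ℕ
bellSum m zero    = S₂ m zero
bellSum m (suc k) = S₂ m (suc k) + bellSum m k

bell : ℕ → ℕ
bell m = bellSum m m

-- A bi-invariant metric d is determined by its norm |g| = d(g, e), which is invariant under
-- conjugation and inversion and vanishes only at e. So |·| is constant on each class
-- C_g ∪ C_{g⁻¹}, and the induced partition is {e} together with a partition of the remaining
-- classes. Conversely every partition of these classes is induced: give the classes of the j-th
-- block the norm B + j with B above every label; norms in {0} ∪ [B, 2B) make the triangle
-- inequality automatic. Inversion acts on the c(G) conjugacy classes as an involution with c₂(G)
-- fixed points, so there are (c + c₂)/2 = k* + 1 classes C_g ∪ C_{g⁻¹}, and M*(G) counts the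
-- set partitions of a k*-element set.
module Submission where

open import Algebra.Bundles using (Group)
import Algebra.Properties.Group as GroupProperties
open import Data.Bool using (Bool) renaming (_<_ to _<ᵇ_)
import Data.Bool.Properties as Bool
open import Data.Empty using (⊥-elim)
open import Data.Fin using (Fin; zero; suc; punchIn; punchOut)
open import Data.Fin.Properties using (any?; punchIn-punchOut) renaming (_≟_ to _≟ᶠ_)
import Data.Integer as ℤ
import Data.Integer.Properties as ℤ
open import Data.List using (List; []; _∷_; [_]; _++_; map; filter; length; upTo; cartesianProductWith; deduplicate; allFin)
import Data.List as List
open import Data.List.Properties using (length-++; length-map; length-upTo; filter-accept; filter-reject)
open import Data.List.Membership.Propositional using (_∈_)
open import Data.List.Membership.Propositional.Properties
  using ( ∈-++⁻; ∈-++⁺ˡ; ∈-++⁺ʳ; ∈-map⁺; ∈-map⁻; ∈-cartesianProductWith⁺; ∈-cartesianProductWith⁻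
        ; ∈-upTo⁺; ∈-upTo⁻; ∈-filter⁺; ∈-filter⁻; ∈-deduplicate⁺; ∈-deduplicate⁻; ∈-allFin; ∈-lookup)
open import Data.List.Membership.Propositional.Properties.WithK using (unique∧set⇒bag; unique⇒irrelevant)
import Data.List.Membership.Setoid.Properties as Membership
open import Data.List.Relation.Binary.BagAndSetEquality using (∼bag⇒↭)
open import Data.List.Relation.Binary.Permutation.Propositional.Properties using (↭-length)
import Data.List.Relation.Unary.All as All
open import Data.List.Relation.Unary.All using ([])
open import Data.List.Relation.Unary.All.Properties using () renaming (map⁺ to All-map⁺)
open import Data.List.Relation.Unary.AllPairs using ([]; _∷_)
open import Data.List.Relation.Unary.Any using (here; there; index)
open import Data.List.Relation.Unary.Unique.Propositional using (Unique)
import Data.List.Relation.Unary.Unique.Propositional.Properties as Unique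
open import Data.List.Relation.Unary.Unique.DecPropositional.Properties using (deduplicate-!)
open import Data.Nat using (ℕ; zero; suc; _+_; _*_; _∸_; _<_; _≤_; z≤n; s≤s)
open import Data.Nat.DivMod using (_/_; m*n/n≡m)
open import Data.Nat.Properties
  using ( <-cmp; <-irrefl; ≤-refl; ≤-reflexive; ≤-trans; <⇒≤; <-≤-trans; m≤n⇒m<n∨m≡n; m≤n⇒m≤1+n
        ; m≤m+n; m≤n+m; +-suc; +-identityʳ; +-cancelˡ-≡; +-mono-≤; +-monoʳ-<)
open import Data.Nat.Tactic.RingSolver using (solve-∀)
open import Data.Product using (_×_; _,_; ∃; ∃₂; proj₁; proj₂)
open import Data.Rational using (ℚ; ↥_; *≤*) renaming (_≤_ to _≤ℚ_; _+_ to _+ℚ_; _≟_ to _≟ℚ_; _/_ to _/ℚ_)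
open import Data.Rational.Literals using (fromℤ)
open import Data.Rational.Properties using (↥p/↧p≡p)
open import Data.Sum using (_⊎_; inj₁; inj₂)
open import Data.Vec using (Vec; []; _∷_; lookup; tabulate; insertAt; sum)
import Data.Vec as Vec
open import Data.Vec.Properties
  using ( ∷-injective; ∷-injectiveʳ; tabulate-cong; lookup∘tabulate; tabulate∘lookup; ≡-dec
        ; insertAt-lookup; insertAt-punchIn; lookup-map)
open import Data.Vec.Relation.Binary.Lex.Strict as Lex using (Lex-<)
open import Data.Vec.Relation.Binary.Pointwise.Inductive using (Pointwise-≡⇒≡; ≡⇒Pointwise-≡)
open import Function.Base using (_∘_)
open import Function.Bundles using (mk⇔; Equivalence)
open import Level using (0ℓ)
open import Relation.Binary.Consequences using (tri⇒dec≈; tri⇒dec<; tri⇒irr; tri⇒asym)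
open import Relation.Binary.Core using (Rel)
open import Relation.Binary.Definitions using (Decidable; DecidableEquality; Trichotomous; tri<; tri≈; tri>)
open import Relation.Binary.PropositionalEquality
  using (_≡_; _≢_; refl; sym; trans; cong; cong₂; subst; subst₂; isEquivalence; setoid; module ≡-Reasoning)
open import Relation.Nullary using (Dec; yes; no; does; ¬_)
open import Relation.Nullary.Decidable using (does-⇔)
open import Defs

does-≡⇒ : ∀ {A B : Set} (a? : Dec A) (b? : Dec B) → does a? ≡ does b? → A → B
does-≡⇒ (yes _) (yes b) _  _ = b
does-≡⇒ (yes _) (no _)  () _
does-≡⇒ (no ¬a) _       _  a = ⊥-elim (¬a a)

lookup≤sum : ∀ {m} (v : Vec ℕ m) i → lookup v i ≤ sum v
lookup≤sum (x ∷ v) zero    = m≤m+n x (sum v)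
lookup≤sum (x ∷ v) (suc i) = ≤-trans (lookup≤sum v i) (m≤n+m (sum v) x)

length-cartesianProductWith : ∀ {A B C : Set} (f : A → B → C) xs ys →
  length (cartesianProductWith f xs ys) ≡ length xs * length ys
length-cartesianProductWith f []       ys = refl
length-cartesianProductWith f (x ∷ xs) ys =
  trans (length-++ (map (f x) ys)) (cong₂ _+_ (length-map (f x) ys) (length-cartesianProductWith f xs ys))

length≡suc-pred : ∀ {A : Set} {x : A} {xs} → x ∈ xs → length xs ≡ suc (length xs ∸ 1)
length≡suc-pred {xs = _ ∷ _} _ = refl

unique∧set⇒length-≡ : ∀ {A : Set} {xs ys : List A} → Unique xs → Unique ys →
  (∀ {z} → z ∈ xs → z ∈ ys) → (∀ {z} → z ∈ ys → z ∈ xs) → length xs ≡ length ys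
unique∧set⇒length-≡ xs! ys! xs⊆ys ys⊆xs = ↭-length (∼bag⇒↭ (unique∧set⇒bag xs! ys! (mk⇔ xs⊆ys ys⊆xs)))

map-injectiveOn⁺ : ∀ {A B : Set} (f : A → B) {xs : List A} →
  (∀ {x y} → x ∈ xs → y ∈ xs → f x ≡ f y → x ≡ y) → Unique xs → Unique (map f xs)
map-injectiveOn⁺ f {[]}     _   []         = []
map-injectiveOn⁺ f {x ∷ xs} inj (x∉ ∷ xs!) =
  All-map⁺ (All.tabulate λ y∈ fx≡fy → All.lookup x∉ y∈ (inj (here refl) (there y∈) fx≡fy))
  ∷ map-injectiveOn⁺ f (λ x∈ y∈ → inj (there x∈) (there y∈)) xs!

index-cong : ∀ {A : Set} {xs : List A} {x y} → Unique xs → (p : x ∈ xs) (q : y ∈ xs) → x ≡ y → index p ≡ index q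
index-cong xs! p q refl = cong index (unique⇒irrelevant xs! p q)

index-∈-lookup : ∀ {A : Set} (xs : List A) i → index (∈-lookup {xs = xs} i) ≡ i
index-∈-lookup (x ∷ xs) zero    = refl
index-∈-lookup (x ∷ xs) (suc i) = cong suc (index-∈-lookup xs i)

-- Set partitions

infix 4 _⊆ker_
_⊆ker_ : ∀ {X A B : Set} → (X → A) → (X → B) → Set
f ⊆ker g = ∀ x y → f x ≡ f y → g x ≡ g y

⊆ker-∷ : ∀ {m} {A B : Set} {f : Fin (suc m) → A} {g : Fin (suc m) → B} →
  (f ∘ suc) ⊆ker (g ∘ suc) → (∀ b → f zero ≡ f (suc b) → g zero ≡ g (suc b)) → f ⊆ker g
⊆ker-∷ tail head zero    zero    _  = refl
⊆ker-∷ tail head zero    (suc b)    = head b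
⊆ker-∷ tail head (suc a) zero    eq = sym (head a (sym eq))
⊆ker-∷ tail head (suc a) (suc b)    = tail a b

-- π ∈ partitions m j labels the points of Fin m by the blocks 0 … j-1 of a set partition:
-- its head either joins one of the blocks of its tail or opens block j, the first label the
-- tail does not use (a restricted growth string, read from the right).
partitions : (m j : ℕ) → List (Vec ℕ m)
partitions zero    zero    = [ [] ]
partitions zero    (suc j) = []
partitions (suc m) zero    = []
partitions (suc m) (suc j) =
  cartesianProductWith _∷_ (upTo (suc j)) (partitions m (suc j)) ++ map (j ∷_) (partitions m j)

data Extension (m : ℕ) : ℕ → Vec ℕ (suc m) → Set where
  join  : ∀ {j x π} → x < j → π ∈ partitions m j → Extension m j (x ∷ π)
  fresh : ∀ {j π} → π ∈ partitions m j → Extension m (suc j) (j ∷ π)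

module _ {m : ℕ} where

  ∈-partitions⁻ : ∀ {j π} → π ∈ partitions (suc m) j → Extension m j π
  ∈-partitions⁻ {suc j} π∈ with ∈-++⁻ (cartesianProductWith _∷_ (upTo (suc j)) (partitions m (suc j))) π∈
  ... | inj₁ p with ∈-cartesianProductWith⁻ _∷_ (upTo (suc j)) (partitions m (suc j)) p
  ...   | x , π , x∈ , π∈′ , refl = join (∈-upTo⁻ x∈) π∈′
  ∈-partitions⁻ {suc j} π∈ | inj₂ p with ∈-map⁻ (j ∷_) p
  ... | π , π∈′ , refl = fresh π∈′

  ∈-partitions⁺ : ∀ {j π} → Extension m j π → π ∈ partitions (suc m) j
  ∈-partitions⁺ {zero}  (join () _)
  ∈-partitions⁺ {suc j} (join x< π∈) = ∈-++⁺ˡ (∈-cartesianProductWith⁺ _∷_ (∈-upTo⁺ x<) π∈)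
  ∈-partitions⁺ {suc j} (fresh π∈)   =
    ∈-++⁺ʳ (cartesianProductWith _∷_ (upTo (suc j)) (partitions m (suc j))) (∈-map⁺ (j ∷_) π∈)

  tail-∈-partitions : ∀ {j x π} → Extension m j (x ∷ π) → ∃ λ i → π ∈ partitions m i
  tail-∈-partitions (join _ π∈) = _ , π∈
  tail-∈-partitions (fresh π∈)  = _ , π∈

label-< : ∀ m {j π} → π ∈ partitions m j → ∀ a → lookup π a < j
label-< zero    {zero} (here refl) ()
label-< (suc m) {j} {π} π∈ a with ∈-partitions⁻ {j = j} π∈
label-< (suc m) π∈ zero    | join x< _  = x<
label-< (suc m) π∈ (suc a) | join _ π∈′ = label-< m π∈′ a
label-< (suc m) π∈ zero    | fresh _    = ≤-refl
label-< (suc m) π∈ (suc a) | fresh π∈′  = m≤n⇒m≤1+n (label-< m π∈′ a)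

label-surjective : ∀ m {j π} → π ∈ partitions m j → ∀ {x} → x < j → ∃ λ a → lookup π a ≡ x
label-surjective zero    {zero} _ ()
label-surjective (suc m) {j} {π} π∈ x< with ∈-partitions⁻ {j = j} π∈
... | join _ π∈′ with label-surjective m π∈′ x<
...   | a , eq = suc a , eq
label-surjective (suc m) π∈ (s≤s x≤j) | fresh π∈′ with m≤n⇒m<n∨m≡n x≤j
... | inj₂ refl = zero , refl
... | inj₁ x<j with label-surjective m π∈′ x<j
...   | a , eq = suc a , eq

blocks-unique : ∀ m {j j′ π} → π ∈ partitions m j → π ∈ partitions m j′ → j ≡ j′
blocks-unique m {j} {j′} π∈ π∈′ with <-cmp j j′
... | tri≈ _ eq _ = eq
... | tri< j<j′ _ _ with label-surjective m π∈′ j<j′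
...   | a , eq = ⊥-elim (<-irrefl eq (label-< m π∈ a))
blocks-unique m π∈ π∈′ | tri> _ _ j′<j with label-surjective m π∈ j′<j
...   | a , eq = ⊥-elim (<-irrefl eq (label-< m π∈′ a))

blocks-≤ : ∀ m {j π} → π ∈ partitions m j → j ≤ m
blocks-≤ zero    {zero} _ = z≤n
blocks-≤ (suc m) {j} {π} π∈ with ∈-partitions⁻ {j = j} π∈
... | join _ π∈′ = m≤n⇒m≤1+n (blocks-≤ m π∈′)
... | fresh π∈′  = s≤s (blocks-≤ m π∈′)

head-determined : ∀ {m x y} {π ρ : Vec ℕ m} → π ≡ ρ → (∃ λ a → lookup π a ≡ x) →
  lookup (x ∷ π) ⊆ker lookup (y ∷ ρ) → y ≡ x
head-determined refl (a , eq) ker = trans (ker zero (suc a) (sym eq)) eq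

partitions-⊆ker-antisym : ∀ m {j j′ π ρ} → π ∈ partitions m j → ρ ∈ partitions m j′ →
  lookup π ⊆ker lookup ρ → lookup ρ ⊆ker lookup π → π ≡ ρ
partitions-⊆ker-antisym zero {π = []} {[]} _ _ _ _ = refl
partitions-⊆ker-antisym (suc m) {j} {j′} {x ∷ π} {y ∷ ρ} π∈ ρ∈ ker⇒ ker⇐ = cong₂ _∷_ head tail
  where
  tail : π ≡ ρ
  tail with tail-∈-partitions (∈-partitions⁻ {j = j} π∈) | tail-∈-partitions (∈-partitions⁻ {j = j′} ρ∈)
  ... | _ , π∈′ | _ , ρ∈′ =
    partitions-⊆ker-antisym m π∈′ ρ∈′ (λ a b → ker⇒ (suc a) (suc b)) (λ a b → ker⇐ (suc a) (suc b))
  head : x ≡ y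
  head with ∈-partitions⁻ {j = j} π∈ | ∈-partitions⁻ {j = j′} ρ∈
  ... | join x< π∈′ | _          = sym (head-determined tail (label-surjective m π∈′ x<) ker⇒)
  ... | fresh _     | join y< ρ∈′ = head-determined (sym tail) (label-surjective m ρ∈′ y<) ker⇐
  ... | fresh π∈′   | fresh ρ∈′   = blocks-unique m π∈′ (subst (λ σ → σ ∈ partitions m _) (sym tail) ρ∈′)

length-partitions : ∀ m j → length (partitions m j) ≡ S₂ m j
length-partitions zero    zero    = refl
length-partitions zero    (suc j) = refl
length-partitions (suc m) zero    = refl
length-partitions (suc m) (suc j) = trans
  (length-++ (cartesianProductWith _∷_ (upTo (suc j)) (partitions m (suc j))))
  (cong₂ _+_
    (trans (length-cartesianProductWith _∷_ (upTo (suc j)) (partitions m (suc j)))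
           (cong₂ _*_ (length-upTo (suc j)) (length-partitions m (suc j))))
    (trans (length-map (j ∷_) (partitions m j)) (length-partitions m j)))

partitions-unique : ∀ m j → Unique (partitions m j)
partitions-unique zero    zero    = [] ∷ []
partitions-unique zero    (suc j) = []
partitions-unique (suc m) zero    = []
partitions-unique (suc m) (suc j) = Unique.++⁺
  (Unique.cartesianProductWith⁺ _∷_ ∷-injective (Unique.upTo⁺ (suc j)) (partitions-unique m (suc j)))
  (Unique.map⁺ ∷-injectiveʳ (partitions-unique m j))
  disjoint
  where
  disjoint : ∀ {π} →
    ¬ (π ∈ cartesianProductWith _∷_ (upTo (suc j)) (partitions m (suc j)) × π ∈ map (j ∷_) (partitions m j))
  disjoint (p , q) with ∈-cartesianProductWith⁻ _∷_ (upTo (suc j)) (partitions m (suc j)) p | ∈-map⁻ (j ∷_) q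
  ... | _ , π , _ , π∈ , refl | _ , π∈′ , eq with ∷-injective eq
  ...   | _ , refl = <-irrefl (blocks-unique m π∈′ π∈) ≤-refl

partition-of : ∀ {A : Set} → DecidableEquality A → ∀ m (f : Fin m → A) →
  ∃₂ λ j π → π ∈ partitions m j × lookup π ⊆ker f × f ⊆ker lookup π
partition-of _≟_ zero    f = zero , [] , here refl , (λ ()) , (λ ())
partition-of _≟_ (suc m) f with partition-of _≟_ m (f ∘ suc) | any? (λ a → f zero ≟ f (suc a))
... | j , π , π∈ , π⊆f , f⊆π | yes (a , fa) =
  j , lookup π a ∷ π , ∈-partitions⁺ (join (label-< m π∈ a) π∈) ,
  ⊆ker-∷ π⊆f (λ b eq → trans fa (π⊆f a b eq)) ,
  ⊆ker-∷ f⊆π (λ b eq → f⊆π a b (trans (sym fa) eq))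
... | j , π , π∈ , π⊆f , f⊆π | no ¬fa =
  suc j , j ∷ π , ∈-partitions⁺ (fresh π∈) ,
  ⊆ker-∷ π⊆f (λ b eq → ⊥-elim (<-irrefl (sym eq) (label-< m π∈ b))) ,
  ⊆ker-∷ f⊆π (λ b eq → ⊥-elim (¬fa (b , eq)))

partitionsUpTo : (m k : ℕ) → List (Vec ℕ m)
partitionsUpTo m zero    = partitions m zero
partitionsUpTo m (suc k) = partitions m (suc k) ++ partitionsUpTo m k

module _ {m : ℕ} where

  ∈-partitionsUpTo⁺ : ∀ {j k π} → j ≤ k → π ∈ partitions m j → π ∈ partitionsUpTo m k
  ∈-partitionsUpTo⁺ {k = zero}  z≤n π∈ = π∈
  ∈-partitionsUpTo⁺ {k = suc k} j≤ π∈ with m≤n⇒m<n∨m≡n j≤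
  ... | inj₁ (s≤s j≤k) = ∈-++⁺ʳ (partitions m (suc k)) (∈-partitionsUpTo⁺ j≤k π∈)
  ... | inj₂ refl      = ∈-++⁺ˡ π∈

  ∈-partitionsUpTo⁻ : ∀ k {π} → π ∈ partitionsUpTo m k → ∃ λ j → j ≤ k × π ∈ partitions m j
  ∈-partitionsUpTo⁻ zero    π∈ = zero , z≤n , π∈
  ∈-partitionsUpTo⁻ (suc k) π∈ with ∈-++⁻ (partitions m (suc k)) π∈
  ... | inj₁ π∈′ = suc k , ≤-refl , π∈′
  ... | inj₂ π∈′ with ∈-partitionsUpTo⁻ k π∈′
  ...   | j , j≤k , π∈″ = j , m≤n⇒m≤1+n j≤k , π∈″

  length-partitionsUpTo : ∀ k → length (partitionsUpTo m k) ≡ bellSum m k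
  length-partitionsUpTo zero    = length-partitions m zero
  length-partitionsUpTo (suc k) =
    trans (length-++ (partitions m (suc k))) (cong₂ _+_ (length-partitions m (suc k)) (length-partitionsUpTo k))

  partitionsUpTo-unique : ∀ k → Unique (partitionsUpTo m k)
  partitionsUpTo-unique zero    = partitions-unique m zero
  partitionsUpTo-unique (suc k) = Unique.++⁺ (partitions-unique m (suc k)) (partitionsUpTo-unique k) disjoint
    where
    disjoint : ∀ {π} → ¬ (π ∈ partitions m (suc k) × π ∈ partitionsUpTo m k)
    disjoint (π∈ , π∈′) with ∈-partitionsUpTo⁻ k π∈′
    ... | j , j≤k , π∈″ = <-irrefl (blocks-unique m π∈″ π∈) (s≤s j≤k)

setPartitions : (m : ℕ) → List (Vec ℕ m)
setPartitions m = partitionsUpTo m m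

setPartition-of : ∀ {A : Set} → DecidableEquality A → ∀ {m} (f : Fin m → A) →
  ∃ λ π → π ∈ setPartitions m × lookup π ⊆ker f × f ⊆ker lookup π
setPartition-of _≟_ {m} f with partition-of _≟_ m f
... | j , π , π∈ , π⊆f , f⊆π = π , ∈-partitionsUpTo⁺ (blocks-≤ m π∈) π∈ , π⊆f , f⊆π

setPartitions-⊆ker-antisym : ∀ m {π ρ} → π ∈ setPartitions m → ρ ∈ setPartitions m →
  lookup π ⊆ker lookup ρ → lookup ρ ⊆ker lookup π → π ≡ ρ
setPartitions-⊆ker-antisym m π∈ ρ∈ with ∈-partitionsUpTo⁻ m π∈ | ∈-partitionsUpTo⁻ m ρ∈
... | _ , _ , π∈′ | _ , _ , ρ∈′ = partitions-⊆ker-antisym m π∈′ ρ∈′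

-- Orbits of an involution

module InvolutionOrbits {A : Set} {_<_ : Rel A 0ℓ} (compare : Trichotomous _≡_ _<_)
  (σ : A → A) (σ-involutive : ∀ x → σ (σ x) ≡ x) where

  private
    _≟_ : DecidableEquality A
    _≟_ = tri⇒dec≈ compare

    _<?_ : Decidable _<_
    _<?_ = tri⇒dec< compare

  σ-swap : ∀ {x y} → σ x ≡ y → x ≡ σ y
  σ-swap {x} eq = trans (sym (σ-involutive x)) (cong σ eq)

  σ-injective : ∀ {x y} → σ x ≡ σ y → x ≡ y
  σ-injective {x} {y} eq = trans (σ-swap eq) (σ-involutive y)

  -- orbits xs keeps one point of each σ-orbit: the fixed points and the smaller point of each 2-cycle.
  fixed lower upper orbits : List A → List A
  fixed  = filter (λ x → x ≟ σ x)
  lower  = filter (λ x → x <? σ x)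
  upper  = filter (λ x → σ x <? x)
  orbits xs = fixed xs ++ lower xs

  length-lower+fixed+upper : ∀ xs → length (lower xs) + length (fixed xs) + length (upper xs) ≡ length xs
  length-lower+fixed+upper [] = refl
  -- Abstracting compare x (σ x) computes lower and fixed; upper decides via compare (σ x) x and needs a rewrite.
  length-lower+fixed+upper (x ∷ xs) with compare x (σ x)
  ... | tri< _ _ σx≮x rewrite filter-reject (λ x → σ x <? x) {xs = xs} σx≮x =
    cong suc (length-lower+fixed+upper xs)
  ... | tri≈ _ _ σx≮x rewrite filter-reject (λ x → σ x <? x) {xs = xs} σx≮x =
    trans (cong (_+ length (upper xs)) (+-suc (length (lower xs)) (length (fixed xs))))
          (cong suc (length-lower+fixed+upper xs))
  ... | tri> _ _ σx<x rewrite filter-accept (λ x → σ x <? x) {xs = xs} σx<x =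
    trans (+-suc (length (lower xs) + length (fixed xs)) (length (upper xs)))
          (cong suc (length-lower+fixed+upper xs))

  orbitRep : A → A
  orbitRep x with σ x <? x
  ... | yes _ = σ x
  ... | no  _ = x

  orbitRep-< : ∀ {x} → σ x < x → orbitRep x ≡ σ x
  orbitRep-< {x} σx<x with σ x <? x
  ... | yes _    = refl
  ... | no σx≮x = ⊥-elim (σx≮x σx<x)

  orbitRep-≮ : ∀ {x} → ¬ σ x < x → orbitRep x ≡ x
  orbitRep-≮ {x} σx≮x with σ x <? x
  ... | yes σx<x = ⊥-elim (σx≮x σx<x)
  ... | no _     = refl

  orbitRep-cases : ∀ x → orbitRep x ≡ x ⊎ orbitRep x ≡ σ x
  orbitRep-cases x with σ x <? x
  ... | yes _ = inj₂ refl
  ... | no  _ = inj₁ refl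

  orbitRep-σ : ∀ x → orbitRep (σ x) ≡ orbitRep x
  orbitRep-σ x with compare x (σ x)
  ... | tri< x<σx _ σx≮x = trans (orbitRep-< (subst (_< σ x) (sym (σ-involutive x)) x<σx))
                                 (trans (σ-involutive x) (sym (orbitRep-≮ σx≮x)))
  ... | tri≈ _ x≡σx _     = cong orbitRep (sym x≡σx)
  ... | tri> x≮σx _ σx<x = trans (orbitRep-≮ (λ σσx<σx → x≮σx (subst (_< σ x) (σ-involutive x) σσx<σx)))
                                 (sym (orbitRep-< σx<x))

  orbitRep-≡⇒ : ∀ {x y} → orbitRep x ≡ orbitRep y → x ≡ y ⊎ x ≡ σ y
  orbitRep-≡⇒ {x} {y} eq with orbitRep-cases x | orbitRep-cases y
  ... | inj₁ ex | inj₁ ey = inj₁ (trans (sym ex) (trans eq ey))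
  ... | inj₁ ex | inj₂ ey = inj₂ (trans (sym ex) (trans eq ey))
  ... | inj₂ ex | inj₁ ey = inj₂ (σ-swap (trans (sym ex) (trans eq ey)))
  ... | inj₂ ex | inj₂ ey = inj₁ (σ-injective (trans (sym ex) (trans eq ey)))

  ≡⇒orbitRep-≡ : ∀ {x y} → x ≡ y ⊎ x ≡ σ y → orbitRep x ≡ orbitRep y
  ≡⇒orbitRep-≡ (inj₁ refl) = refl
  ≡⇒orbitRep-≡ (inj₂ refl) = orbitRep-σ _

  ∈-fixed⁺ : ∀ {x xs} → x ∈ xs → x ≡ σ x → x ∈ fixed xs
  ∈-fixed⁺ = ∈-filter⁺ (λ x → x ≟ σ x)

  ∈-fixed⁻ : ∀ {x} xs → x ∈ fixed xs → x ∈ xs × x ≡ σ x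
  ∈-fixed⁻ xs = ∈-filter⁻ (λ x → x ≟ σ x) {xs = xs}

  fixed-unique : ∀ {xs} → Unique xs → Unique (fixed xs)
  fixed-unique = Unique.filter⁺ (λ x → x ≟ σ x)

  module _ {xs : List A} (xs-unique : Unique xs) (σ-closed : ∀ {x} → x ∈ xs → σ x ∈ xs) where

    orbitRep-∈ : ∀ {x} → x ∈ xs → orbitRep x ∈ orbits xs
    orbitRep-∈ {x} x∈ with compare x (σ x)
    ... | tri< x<σx _ σx≮x = subst (_∈ orbits xs) (sym (orbitRep-≮ σx≮x))
                               (∈-++⁺ʳ (fixed xs) (∈-filter⁺ (λ x → x <? σ x) x∈ x<σx))
    ... | tri≈ _ x≡σx σx≮x = subst (_∈ orbits xs) (sym (orbitRep-≮ σx≮x))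
                               (∈-++⁺ˡ (∈-fixed⁺ x∈ x≡σx))
    ... | tri> _ _ σx<x    = subst (_∈ orbits xs) (sym (orbitRep-< σx<x))
                               (∈-++⁺ʳ (fixed xs) (∈-filter⁺ (λ x → x <? σ x) (σ-closed x∈)
                                 (subst (σ x <_) (sym (σ-involutive x)) σx<x)))

    ∈-orbits⁻ : ∀ {y} → y ∈ orbits xs → y ∈ xs × orbitRep y ≡ y
    ∈-orbits⁻ y∈ with ∈-++⁻ (fixed xs) y∈
    ... | inj₁ y∈f with ∈-fixed⁻ xs y∈f
    ...   | y∈xs , y≡σy = y∈xs , orbitRep-≮ (tri⇒irr compare (sym y≡σy))
    ∈-orbits⁻ y∈ | inj₂ y∈l with ∈-filter⁻ (λ x → x <? σ x) y∈l
    ...   | y∈xs , y<σy = y∈xs , orbitRep-≮ (tri⇒asym compare y<σy)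

    orbits-unique : Unique (orbits xs)
    orbits-unique = Unique.++⁺ (fixed-unique xs-unique) (Unique.filter⁺ (λ x → x <? σ x) xs-unique)
      λ (y∈f , y∈l) →
        tri⇒irr compare (proj₂ (∈-fixed⁻ xs y∈f)) (proj₂ (∈-filter⁻ (λ x → x <? σ x) {xs = xs} y∈l))

    length-lower≡upper : length (lower xs) ≡ length (upper xs)
    length-lower≡upper = trans (sym (length-map σ (lower xs)))
      (unique∧set⇒length-≡ (Unique.map⁺ σ-injective (Unique.filter⁺ (λ x → x <? σ x) xs-unique))
                           (Unique.filter⁺ (λ x → σ x <? x) xs-unique) σlower⊆upper upper⊆σlower)
      where
      σlower⊆upper : ∀ {z} → z ∈ map σ (lower xs) → z ∈ upper xs
      σlower⊆upper z∈ with ∈-map⁻ σ z∈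
      ... | y , y∈ , refl with ∈-filter⁻ (λ x → x <? σ x) y∈
      ...   | y∈xs , y<σy = ∈-filter⁺ (λ x → σ x <? x) (σ-closed y∈xs) (subst (_< σ _) (sym (σ-involutive _)) y<σy)
      upper⊆σlower : ∀ {z} → z ∈ upper xs → z ∈ map σ (lower xs)
      upper⊆σlower {z} z∈ with ∈-filter⁻ (λ x → σ x <? x) z∈
      ... | z∈xs , σz<z = subst (_∈ map σ (lower xs)) (σ-involutive z)
        (∈-map⁺ σ (∈-filter⁺ (λ x → x <? σ x) (σ-closed z∈xs) (subst (σ z <_) (sym (σ-involutive z)) σz<z)))

    length-orbits : length xs + length (fixed xs) ≡ length (orbits xs) * 2
    length-orbits = begin
      length xs + f                       ≡⟨ cong (_+ f) (sym (length-lower+fixed+upper xs)) ⟩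
      l + f + length (upper xs) + f       ≡⟨ cong (λ u → l + f + u + f) (sym length-lower≡upper) ⟩
      l + f + l + f                       ≡⟨ twice l f ⟩
      (f + l) * 2                         ≡⟨ cong (_* 2) (sym (length-++ (fixed xs))) ⟩
      length (orbits xs) * 2              ∎
      where
      open ≡-Reasoning
      l f : ℕ
      l = length (lower xs)
      f = length (fixed xs)
      twice : ∀ a b → a + b + a + b ≡ (b + a) * 2
      twice = solve-∀

-- Groups and bi-invariant metrics

fromℕ : ℕ → ℚ
fromℕ m = fromℤ (ℤ.+ m)

fromℕ-injective : ∀ {m n} → fromℕ m ≡ fromℕ n → m ≡ n
fromℕ-injective eq = ℤ.+-injective (cong ↥_ eq)

fromℕ-mono-≤ : ∀ {m n} → m ≤ n → fromℕ m ≤ℚ fromℕ n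
fromℕ-mono-≤ {m} {n} m≤n =
  *≤* (subst₂ ℤ._≤_ (sym (ℤ.*-identityʳ (ℤ.+ m))) (sym (ℤ.*-identityʳ (ℤ.+ n))) (ℤ.+≤+ m≤n))

fromℕ-homo-+ : ∀ m n → fromℕ (m + n) ≡ fromℕ m +ℚ fromℕ n
fromℕ-homo-+ m n = sym (trans (cong (_/ℚ 1) (cong₂ ℤ._+_ (ℤ.*-identityʳ (ℤ.+ m)) (ℤ.*-identityʳ (ℤ.+ n))))
                              (↥p/↧p≡p (fromℕ (m + n))))

group : FinGroup → Group 0ℓ 0ℓ
group G = record
  { Carrier = Fin n ; _≈_ = _≡_ ; _∙_ = _·_ ; ε = e ; _⁻¹ = inv
  ; isGroup = record
    { isMonoid = record
      { isSemigroup = record { isMagma = record { isEquivalence = isEquivalence ; ∙-cong = cong₂ _·_ } ; assoc = assoc }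
      ; identity = idˡ , idʳ }
    ; inverse = invˡ , invʳ
    ; ⁻¹-cong = cong inv } }
  where open FinGroup G

module _ (G : FinGroup) where
  open FinGroup G
  open GroupProperties (group G) using (⁻¹-involutive; ⁻¹-anti-homo-∙; x∙y⁻¹≈ε⇒x≈y; ε⁻¹≈ε)
  open ≡-Reasoning

  conj : Fin n → Fin n → Fin n
  conj x g = (x · g) · inv x

  Conjugate : Fin n → Fin n → Set
  Conjugate g h = ∃ λ x → conj x g ≡ h

  infix 4 _∼_
  _∼_ : Fin n → Fin n → Set
  g ∼ h = Conjugate g h ⊎ Conjugate g (inv h)

  ·-inv-cancelʳ : ∀ x y → (x · y) · inv y ≡ x
  ·-inv-cancelʳ x y = trans (assoc x y (inv y)) (trans (cong (x ·_) (invʳ y)) (idʳ x))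

  inv-·-cancelʳ : ∀ x y → (x · inv y) · y ≡ x
  inv-·-cancelʳ x y = trans (assoc x (inv y) y) (trans (cong (x ·_) (invˡ y)) (idʳ x))

  ·inv-e : ∀ x → x · inv e ≡ x
  ·inv-e x = trans (cong (x ·_) ε⁻¹≈ε) (idʳ x)

  conj-e : ∀ g → conj e g ≡ g
  conj-e g = trans (·inv-e (e · g)) (idˡ g)

  conj-∘ : ∀ x y g → conj y (conj x g) ≡ conj (y · x) g
  conj-∘ x y g = begin
    (y · ((x · g) · inv x)) · inv y     ≡⟨ cong (_· inv y) (sym (assoc y (x · g) (inv x))) ⟩
    ((y · (x · g)) · inv x) · inv y     ≡⟨ assoc (y · (x · g)) (inv x) (inv y) ⟩
    (y · (x · g)) · (inv x · inv y)     ≡⟨ cong₂ _·_ (sym (assoc y x g)) (sym (⁻¹-anti-homo-∙ y x)) ⟩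
    ((y · x) · g) · inv (y · x)         ∎

  conj-inverse : ∀ x g → conj (inv x) (conj x g) ≡ g
  conj-inverse x g = trans (conj-∘ x (inv x) g) (trans (cong (λ y → conj y g) (invˡ x)) (conj-e g))

  conj-of-e : ∀ x → conj x e ≡ e
  conj-of-e x = trans (cong (_· inv x) (idʳ x)) (invʳ x)

  inv-conj : ∀ x g → inv (conj x g) ≡ conj x (inv g)
  inv-conj x g = begin
    inv ((x · g) · inv x)               ≡⟨ ⁻¹-anti-homo-∙ (x · g) (inv x) ⟩
    inv (inv x) · inv (x · g)           ≡⟨ cong₂ _·_ (⁻¹-involutive x) (⁻¹-anti-homo-∙ x g) ⟩
    x · (inv g · inv x)                 ≡⟨ sym (assoc x (inv g) (inv x)) ⟩
    (x · inv g) · inv x                 ∎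

  conjugate-refl : ∀ g → Conjugate g g
  conjugate-refl g = e , conj-e g

  conjugate-sym : ∀ {g h} → Conjugate g h → Conjugate h g
  conjugate-sym {g} (x , refl) = inv x , conj-inverse x g

  conjugate-trans : ∀ {g h k} → Conjugate g h → Conjugate h k → Conjugate g k
  conjugate-trans {g} (x , refl) (y , refl) = y · x , sym (conj-∘ x y g)

  conjugate-inv : ∀ {g h} → Conjugate g h → Conjugate (inv g) (inv h)
  conjugate-inv {g} (x , refl) = x , sym (inv-conj x g)

  conjugate-e : ∀ {g} → Conjugate e g → g ≡ e
  conjugate-e (x , refl) = conj-of-e x

  ∼e⇒≡e : ∀ {g} → g ∼ e → g ≡ e
  ∼e⇒≡e (inj₁ g~e)   = conjugate-e (conjugate-sym g~e)
  ∼e⇒≡e (inj₂ g~e⁻¹) = conjugate-e (conjugate-sym (subst (Conjugate _) ε⁻¹≈ε g~e⁻¹))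

  inv-·inv : ∀ x y → inv (x · inv y) ≡ y · inv x
  inv-·inv x y = trans (⁻¹-anti-homo-∙ x (inv y)) (cong (_· inv x) (⁻¹-involutive y))

  ·inv-telescope : ∀ x y z → (x · inv y) · (y · inv z) ≡ x · inv z
  ·inv-telescope x y z = begin
    (x · inv y) · (y · inv z)           ≡⟨ assoc x (inv y) (y · inv z) ⟩
    x · (inv y · (y · inv z))           ≡⟨ cong (x ·_) (sym (assoc (inv y) y (inv z))) ⟩
    x · ((inv y · y) · inv z)           ≡⟨ cong (λ t → x · (t · inv z)) (invˡ y) ⟩
    x · (e · inv z)                     ≡⟨ cong (x ·_) (idˡ (inv z)) ⟩
    x · inv z                           ∎

  ·inv-translateʳ : ∀ g g′ h → (g · h) · inv (g′ · h) ≡ g · inv g′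
  ·inv-translateʳ g g′ h = begin
    (g · h) · inv (g′ · h)              ≡⟨ cong ((g · h) ·_) (⁻¹-anti-homo-∙ g′ h) ⟩
    (g · h) · (inv h · inv g′)          ≡⟨ sym (assoc (g · h) (inv h) (inv g′)) ⟩
    ((g · h) · inv h) · inv g′          ≡⟨ cong (_· inv g′) (·-inv-cancelʳ g h) ⟩
    g · inv g′                          ∎

  ·inv-translateˡ : ∀ g g′ h → (h · g) · inv (h · g′) ≡ conj h (g · inv g′)
  ·inv-translateˡ g g′ h = begin
    (h · g) · inv (h · g′)              ≡⟨ cong ((h · g) ·_) (⁻¹-anti-homo-∙ h g′) ⟩
    (h · g) · (inv g′ · inv h)          ≡⟨ sym (assoc (h · g) (inv g′) (inv h)) ⟩
    ((h · g) · inv g′) · inv h          ≡⟨ cong (_· inv h) (assoc h g (inv g′)) ⟩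
    (h · (g · inv g′)) · inv h          ∎

  normOf : (Fin n → Fin n → ℚ) → Fin n → ℚ
  normOf d g = d g e

  module _ {d : Fin n → Fin n → ℚ} (d-biInv : IsBiInvariantMetric G d) where
    open IsBiInvariantMetric d-biInv
    open IsMetric metric renaming (sym to d-sym)

    normOf-conj : ∀ x g → normOf d (conj x g) ≡ normOf d g
    normOf-conj x g = begin
      d (conj x g) e                      ≡⟨ sym (rightInv (conj x g) e x) ⟩
      d (conj x g · x) (e · x)            ≡⟨ cong₂ d (inv-·-cancelʳ (x · g) x) (trans (idˡ x) (sym (idʳ x))) ⟩
      d (x · g) (x · e)                   ≡⟨ leftInv g e x ⟩
      d g e                               ∎

    normOf-inv : ∀ g → normOf d (inv g) ≡ normOf d g
    normOf-inv g = begin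
      d (inv g) e                         ≡⟨ sym (leftInv (inv g) e g) ⟩
      d (g · inv g) (g · e)               ≡⟨ cong₂ d (invʳ g) (idʳ g) ⟩
      d e g                               ≡⟨ d-sym e g ⟩
      d g e                               ∎

    normOf-∼ : ∀ {g h} → g ∼ h → normOf d g ≡ normOf d h
    normOf-∼ (inj₁ (x , refl)) = sym (normOf-conj x _)
    normOf-∼ {g} {h} (inj₂ (x , x-conj)) = begin
      normOf d g                          ≡⟨ sym (normOf-conj x g) ⟩
      normOf d (conj x g)                 ≡⟨ cong (normOf d) x-conj ⟩
      normOf d (inv h)                    ≡⟨ normOf-inv h ⟩
      normOf d h                          ∎

    normOf-≡e : ∀ {g} → normOf d g ≡ normOf d e → g ≡ e
    normOf-≡e {g} eq = Equivalence.to (zero⇔eq g e) (trans eq (Equivalence.from (zero⇔eq e e) refl))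

  record IsConjugationInvariantNorm (ℓ : Fin n → ℕ) : Set where
    field
      ≡0⇒≡e          : ∀ g → ℓ g ≡ 0 → g ≡ e
      e↦0            : ℓ e ≡ 0
      inv-invariant  : ∀ g → ℓ (inv g) ≡ ℓ g
      conj-invariant : ∀ x g → ℓ (conj x g) ≡ ℓ g
      subadditive    : ∀ g h → ℓ (g · h) ≤ ℓ g + ℓ h

  normMetric : (Fin n → ℕ) → Fin n → Fin n → ℚ
  normMetric ℓ x y = fromℕ (ℓ (x · inv y))

  normOf-normMetric : ∀ ℓ g → normOf (normMetric ℓ) g ≡ fromℕ (ℓ g)
  normOf-normMetric ℓ g = cong (fromℕ ∘ ℓ) (·inv-e g)

  normMetric-isBiInvariant : ∀ {ℓ} → IsConjugationInvariantNorm ℓ → IsBiInvariantMetric G (normMetric ℓ)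
  normMetric-isBiInvariant {ℓ} norm = record
    { metric = record
      { nonneg   = λ x y → fromℕ-mono-≤ z≤n
      ; zero⇔eq  = λ x y → mk⇔ (λ d≡0 → x∙y⁻¹≈ε⇒x≈y x y (≡0⇒≡e _ (fromℕ-injective d≡0)))
                              (λ { refl → cong fromℕ (trans (cong ℓ (invʳ x)) e↦0) })
      ; sym      = λ x y → cong fromℕ (trans (sym (inv-invariant (x · inv y))) (cong ℓ (inv-·inv x y)))
      ; triangle = λ x y z → subst (fromℕ (ℓ (x · inv z)) ≤ℚ_) (fromℕ-homo-+ (ℓ (x · inv y)) (ℓ (y · inv z)))
                     (fromℕ-mono-≤ (subst (λ t → ℓ t ≤ ℓ (x · inv y) + ℓ (y · inv z)) (·inv-telescope x y z)
                                          (subadditive (x · inv y) (y · inv z))))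
      }
    ; rightInv = λ g g′ h → cong (fromℕ ∘ ℓ) (·inv-translateʳ g g′ h)
    ; leftInv  = λ g g′ h → cong fromℕ (trans (cong ℓ (·inv-translateˡ g g′ h)) (conj-invariant h (g · inv g′)))
    }
    where open IsConjugationInvariantNorm norm

  bounded⇒subadditive : ∀ (ℓ : Fin n → ℕ) B →
    ℓ e ≡ 0 → (∀ g → g ≢ e → B ≤ ℓ g) → (∀ g → ℓ g < B + B) → ∀ g h → ℓ (g · h) ≤ ℓ g + ℓ h
  bounded⇒subadditive ℓ B e↦0 ≥B <2B g h with g ≟ᶠ e | h ≟ᶠ e
  ... | yes refl | _ = ≤-reflexive (trans (cong ℓ (idˡ h)) (sym (cong (_+ ℓ h) e↦0)))
  ... | no _ | yes refl = ≤-reflexive (trans (cong ℓ (idʳ g)) (sym (trans (cong (ℓ g +_) e↦0) (+-identityʳ (ℓ g)))))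
  ... | no g≢e | no h≢e = <⇒≤ (<-≤-trans (<2B (g · h)) (+-mono-≤ (≥B g g≢e) (≥B h h≢e)))

  inducedPartition-entry : ∀ d g h → lookup (lookup (inducedPartition G d) g) h ≡ does (normOf d g ≟ℚ normOf d h)
  inducedPartition-entry d g h = trans (cong (λ row → lookup row h) (lookup∘tabulate _ g)) (lookup∘tabulate _ h)

  inducedPartition-≡ : ∀ {d d′} → normOf d ⊆ker normOf d′ → normOf d′ ⊆ker normOf d →
    inducedPartition G d ≡ inducedPartition G d′
  inducedPartition-≡ {d} {d′} d⊆d′ d′⊆d = tabulate-cong λ g → tabulate-cong λ h →
    does-⇔ (mk⇔ (d⊆d′ g h) (d′⊆d g h)) (normOf d g ≟ℚ normOf d h) (normOf d′ g ≟ℚ normOf d′ h)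

  inducedPartition-≡⇒⊆ker : ∀ {d d′} → inducedPartition G d ≡ inducedPartition G d′ → normOf d ⊆ker normOf d′
  inducedPartition-≡⇒⊆ker {d} {d′} eq g h = does-≡⇒ (normOf d g ≟ℚ normOf d h) (normOf d′ g ≟ℚ normOf d′ h)
    (trans (sym (inducedPartition-entry d g h))
           (trans (cong (λ P → lookup (lookup P g) h) eq) (inducedPartition-entry d′ g h)))

-- Conjugacy classes

Lex-<-compare : ∀ {m} → Trichotomous _≡_ (Lex-< _≡_ _<ᵇ_ {m} {m})
Lex-<-compare u v with Lex.<-cmp sym Bool.<-cmp u v
... | tri< u<v u≉v v≮u = tri< u<v (u≉v ∘ ≡⇒Pointwise-≡) v≮u
... | tri≈ u≮v u≈v v≮u = tri≈ u≮v (Pointwise-≡⇒≡ u≈v) v≮u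
... | tri> u≮v u≉v v<u = tri> u≮v (u≉v ∘ ≡⇒Pointwise-≡) v<u

module _ (G : FinGroup) where
  open FinGroup G
  open GroupProperties (group G) using (⁻¹-involutive)

  conjugate? : ∀ g x → Dec (Conjugate G g x)
  conjugate? g x = any? λ h → conj G h g ≟ᶠ x

  conjClass-entry : ∀ g x → lookup (conjClass G g) x ≡ does (conjugate? g x)
  conjClass-entry g = lookup∘tabulate _

  conjClass-≡⇒conjugate : ∀ {g h} → conjClass G g ≡ conjClass G h → Conjugate G g h
  conjClass-≡⇒conjugate {g} {h} eq = does-≡⇒ (conjugate? h h) (conjugate? g h)
    (trans (sym (conjClass-entry h h)) (trans (cong (λ V → lookup V h) (sym eq)) (conjClass-entry g h)))
    (conjugate-refl G h)

  conjugate⇒conjClass-≡ : ∀ {g h} → Conjugate G g h → conjClass G g ≡ conjClass G h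
  conjugate⇒conjClass-≡ {g} {h} g~h = tabulate-cong λ x →
    does-⇔ (mk⇔ (conjugate-trans G (conjugate-sym G g~h)) (conjugate-trans G g~h)) (conjugate? g x) (conjugate? h x)

  invClass : Vec Bool n → Vec Bool n
  invClass V = tabulate λ x → lookup V (inv x)

  invClass-involutive : ∀ V → invClass (invClass V) ≡ V
  invClass-involutive V = trans
    (tabulate-cong λ x → trans (lookup∘tabulate _ (inv x)) (cong (lookup V) (⁻¹-involutive x)))
    (tabulate∘lookup V)

  invClass-conjClass : ∀ g → invClass (conjClass G g) ≡ conjClass G (inv g)
  invClass-conjClass g = tabulate-cong λ x → trans (conjClass-entry g (inv x))
    (does-⇔ (mk⇔ (subst (Conjugate G (inv g)) (⁻¹-involutive x) ∘ conjugate-inv G)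
                 (subst (λ t → Conjugate G t (inv x)) (⁻¹-involutive g) ∘ conjugate-inv G))
            (conjugate? g (inv x)) (conjugate? (inv g) x))

  ∈-conjClasses⁺ : ∀ g → conjClass G g ∈ conjClasses G
  ∈-conjClasses⁺ g = ∈-deduplicate⁺ (≡-dec Bool._≟_) (∈-map⁺ (conjClass G) (∈-allFin g))

  ∈-conjClasses⁻ : ∀ {V} → V ∈ conjClasses G → ∃ λ g → V ≡ conjClass G g
  ∈-conjClasses⁻ V∈ with ∈-map⁻ (conjClass G) (∈-deduplicate⁻ (≡-dec Bool._≟_) (map (conjClass G) (allFin n)) V∈)
  ... | g , _ , V≡ = g , V≡

  conjClasses-unique : Unique (conjClasses G)
  conjClasses-unique = deduplicate-! (≡-dec Bool._≟_) (map (conjClass G) (allFin n))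

  invClass-∈-conjClasses : ∀ {V} → V ∈ conjClasses G → invClass V ∈ conjClasses G
  invClass-∈-conjClasses V∈ with ∈-conjClasses⁻ V∈
  ... | g , refl = subst (_∈ conjClasses G) (sym (invClass-conjClass g)) (∈-conjClasses⁺ (inv g))

  open InvolutionOrbits Lex-<-compare invClass invClass-involutive

  -- one point per class C_g ∪ C_{g⁻¹}
  classes : List (Vec Bool n)
  classes = orbits (conjClasses G)

  c₂≡length-fixed : c₂ G ≡ length (fixed (conjClasses G))
  c₂≡length-fixed = unique∧set⇒length-≡ (deduplicate-! (≡-dec Bool._≟_) (map (conjClass G) (filter real? (allFin n))))
    (fixed-unique conjClasses-unique) real⊆fixed fixed⊆real
    where
    real? : ∀ g → Dec (conjClass G g ≡ conjClass G (inv g))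
    real? g = ≡-dec Bool._≟_ (conjClass G g) (conjClass G (inv g))

    realClasses : List (Vec Bool n)
    realClasses = deduplicate (≡-dec Bool._≟_) (map (conjClass G) (filter real? (allFin n)))

    real⊆fixed : ∀ {V} → V ∈ realClasses → V ∈ fixed (conjClasses G)
    real⊆fixed V∈
      with ∈-map⁻ (conjClass G) (∈-deduplicate⁻ (≡-dec Bool._≟_) (map (conjClass G) (filter real? (allFin n))) V∈)
    ... | g , g∈ , refl = ∈-fixed⁺ (∈-conjClasses⁺ g)
      (trans (proj₂ (∈-filter⁻ real? {xs = allFin n} g∈)) (sym (invClass-conjClass g)))

    fixed⊆real : ∀ {V} → V ∈ fixed (conjClasses G) → V ∈ realClasses
    fixed⊆real V∈ with ∈-fixed⁻ (conjClasses G) V∈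
    ... | V∈′ , V≡ with ∈-conjClasses⁻ V∈′
    ...   | g , refl = ∈-deduplicate⁺ (≡-dec Bool._≟_)
      (∈-map⁺ (conjClass G) (∈-filter⁺ real? (∈-allFin g) (trans V≡ (invClass-conjClass g))))

  c+c₂≡length-classes*2 : c G + c₂ G ≡ length classes * 2
  c+c₂≡length-classes*2 = trans (cong (c G +_) c₂≡length-fixed)
    (length-orbits conjClasses-unique invClass-∈-conjClasses)

  ∼⇒orbitRep-≡ : ∀ {g h} → _∼_ G g h → orbitRep (conjClass G g) ≡ orbitRep (conjClass G h)
  ∼⇒orbitRep-≡ (inj₁ g~h)   = cong orbitRep (conjugate⇒conjClass-≡ g~h)
  ∼⇒orbitRep-≡ {h = h} (inj₂ g~h⁻¹) =
    ≡⇒orbitRep-≡ (inj₂ (trans (conjugate⇒conjClass-≡ g~h⁻¹) (sym (invClass-conjClass h))))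

  orbitRep-≡⇒∼ : ∀ {g h} → orbitRep (conjClass G g) ≡ orbitRep (conjClass G h) → _∼_ G g h
  orbitRep-≡⇒∼ {g} {h} eq with orbitRep-≡⇒ eq
  ... | inj₁ Cg≡Ch    = inj₁ (conjClass-≡⇒conjugate Cg≡Ch)
  ... | inj₂ Cg≡Ch⁻¹ = inj₂ (conjClass-≡⇒conjugate (trans Cg≡Ch⁻¹ (invClass-conjClass h)))

  orbitRep-conjClass-∈ : ∀ g → orbitRep (conjClass G g) ∈ classes
  orbitRep-conjClass-∈ g = orbitRep-∈ conjClasses-unique invClass-∈-conjClasses (∈-conjClasses⁺ g)

  classes-unique : Unique classes
  classes-unique = orbits-unique conjClasses-unique invClass-∈-conjClasses

  lookup-∈-orbits⁻ : ∀ i →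
    List.lookup classes i ∈ conjClasses G × orbitRep (List.lookup classes i) ≡ List.lookup classes i
  lookup-∈-orbits⁻ i = ∈-orbits⁻ conjClasses-unique invClass-∈-conjClasses (∈-lookup i)

  representativeOf : Fin (length classes) → Fin n
  representativeOf i = proj₁ (∈-conjClasses⁻ (proj₁ (lookup-∈-orbits⁻ i)))

  orbitRep-representativeOf : ∀ i → orbitRep (conjClass G (representativeOf i)) ≡ List.lookup classes i
  orbitRep-representativeOf i =
    trans (cong orbitRep (sym (proj₂ (∈-conjClasses⁻ (proj₁ (lookup-∈-orbits⁻ i)))))) (proj₂ (lookup-∈-orbits⁻ i))

module _ (G : FinGroup) where
  open FinGroup G

  record ClassEnumeration (m : ℕ) : Set where
    field
      classOf                : Fin n → Fin m
      representative         : Fin m → Fin n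
      classOf-representative : ∀ i → classOf (representative i) ≡ i
      classOf-≡⇒∼            : ∀ {g h} → classOf g ≡ classOf h → _∼_ G g h
      ∼⇒classOf-≡            : ∀ {g h} → _∼_ G g h → classOf g ≡ classOf h

  classEnumeration : ClassEnumeration (length (classes G))
  classEnumeration = record
    { classOf                = index ∘ orbitRep-conjClass-∈ G
    ; representative         = representativeOf G
    ; classOf-representative = λ i → trans
        (index-cong (classes-unique G) (orbitRep-conjClass-∈ G _) _ (orbitRep-representativeOf G i))
        (index-∈-lookup (classes G) i)
    ; classOf-≡⇒∼            = λ {g} {h} eq → orbitRep-≡⇒∼ G
        (Membership.index-injective (setoid _) (orbitRep-conjClass-∈ G g) (orbitRep-conjClass-∈ G h) eq)
    ; ∼⇒classOf-≡            = λ {g} {h} g∼h →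
        index-cong (classes-unique G) (orbitRep-conjClass-∈ G g) (orbitRep-conjClass-∈ G h) (∼⇒orbitRep-≡ G g∼h)
    }

  module MStar {k : ℕ} (E : ClassEnumeration (suc k)) where
    open ClassEnumeration E

    i₀ : Fin (suc k)
    i₀ = classOf e

    r : Fin k → Fin n
    r a = representative (punchIn i₀ a)

    classView : ∀ g → g ≡ e ⊎ ∃ λ a → classOf g ≡ punchIn i₀ a
    classView g with i₀ ≟ᶠ classOf g
    ... | yes i₀≡ = inj₁ (∼e⇒≡e G (classOf-≡⇒∼ (sym i₀≡)))
    ... | no i₀≢  = inj₂ (punchOut i₀≢ , sym (punchIn-punchOut i₀≢))

    -- Norms are constant on classes and vanish only at e, so their kernels are determined
    -- by the values at the representatives r a of the non-identity classes.
    normOf-⊆ker : ∀ {d d′} → IsBiInvariantMetric G d → IsBiInvariantMetric G d′ →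
      (normOf G d ∘ r) ⊆ker (normOf G d′ ∘ r) → normOf G d ⊆ker normOf G d′
    normOf-⊆ker {d} {d′} d-bi d′-bi r-ker g h eq with classView g | classView h
    ... | inj₁ refl | _ = cong (normOf G d′) (sym (normOf-≡e G d-bi (sym eq)))
    ... | inj₂ _ | inj₁ refl = cong (normOf G d′) (normOf-≡e G d-bi eq)
    ... | inj₂ (a , g∈a) | inj₂ (b , h∈b) = begin
      normOf G d′ g                       ≡⟨ atRep d′-bi g∈a ⟩
      normOf G d′ (r a)                   ≡⟨ r-ker a b (trans (sym (atRep d-bi g∈a)) (trans eq (atRep d-bi h∈b))) ⟩
      normOf G d′ (r b)                   ≡⟨ sym (atRep d′-bi h∈b) ⟩
      normOf G d′ h                       ∎
      where
      open ≡-Reasoning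
      atRep : ∀ {d x a} → IsBiInvariantMetric G d → classOf x ≡ punchIn i₀ a → normOf G d x ≡ normOf G d (r a)
      atRep d-bi x∈a = normOf-∼ G d-bi (classOf-≡⇒∼ (trans x∈a (sym (classOf-representative _))))

    module _ (π : Vec ℕ k) where
      bound : ℕ
      bound = suc (sum π)

      -- Heights lie in {0} ∪ [bound, 2·bound), which makes the norm subadditive.
      heights : Vec ℕ (suc k)
      heights = insertAt (Vec.map (bound +_) π) i₀ 0

      heights-punchIn : ∀ a → lookup heights (punchIn i₀ a) ≡ bound + lookup π a
      heights-punchIn a = trans (insertAt-punchIn (Vec.map (bound +_) π) i₀ 0 a) (lookup-map a (bound +_) π)

      norm : Fin n → ℕ
      norm g = lookup heights (classOf g)

      norm-e : norm e ≡ 0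
      norm-e = insertAt-lookup (Vec.map (bound +_) π) i₀ 0

      norm-cases : ∀ g → g ≡ e ⊎ ∃ λ a → norm g ≡ bound + lookup π a
      norm-cases g with classView g
      ... | inj₁ g≡e       = inj₁ g≡e
      ... | inj₂ (a , g∈a) = inj₂ (a , trans (cong (lookup heights) g∈a) (heights-punchIn a))

      norm-≡0 : ∀ g → norm g ≡ 0 → g ≡ e
      norm-≡0 g norm≡0 with norm-cases g
      ... | inj₁ g≡e = g≡e
      ... | inj₂ (a , norm≡) with trans (sym norm≡0) norm≡
      ...   | ()

      bound≤norm : ∀ g → g ≢ e → bound ≤ norm g
      bound≤norm g g≢e with norm-cases g
      ... | inj₁ g≡e        = ⊥-elim (g≢e g≡e)
      ... | inj₂ (a , norm≡) = subst (bound ≤_) (sym norm≡) (m≤m+n bound (lookup π a))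

      norm<2bound : ∀ g → norm g < bound + bound
      norm<2bound g with norm-cases g
      ... | inj₁ refl        = subst (_< bound + bound) (sym norm-e) (s≤s z≤n)
      ... | inj₂ (a , norm≡) = subst (_< bound + bound) (sym norm≡) (+-monoʳ-< bound (s≤s (lookup≤sum π a)))

      norm-isNorm : IsConjugationInvariantNorm G norm
      norm-isNorm = record
        { ≡0⇒≡e          = norm-≡0
        ; e↦0            = norm-e
        ; inv-invariant  = λ g → cong (lookup heights) (∼⇒classOf-≡ (inj₂ (conjugate-refl G (inv g))))
        ; conj-invariant = λ x g → cong (lookup heights) (∼⇒classOf-≡ (inj₁ (conjugate-sym G (x , refl))))
        ; subadditive    = bounded⇒subadditive G norm bound norm-e bound≤norm norm<2bound
        }

      metricOf : Fin n → Fin n → ℚ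
      metricOf = normMetric G norm

      metricOf-isBiInvariant : IsBiInvariantMetric G metricOf
      metricOf-isBiInvariant = normMetric-isBiInvariant G norm-isNorm

      normOf-metricOf-r : ∀ a → normOf G metricOf (r a) ≡ fromℕ (bound + lookup π a)
      normOf-metricOf-r a = trans (normOf-normMetric G norm (r a))
        (cong fromℕ (trans (cong (lookup heights) (classOf-representative (punchIn i₀ a))) (heights-punchIn a)))

      metricOf-⊆ker : (normOf G metricOf ∘ r) ⊆ker lookup π
      metricOf-⊆ker a b eq = +-cancelˡ-≡ bound _ _
        (fromℕ-injective (trans (sym (normOf-metricOf-r a)) (trans eq (normOf-metricOf-r b))))

      ⊆ker-metricOf : lookup π ⊆ker (normOf G metricOf ∘ r)
      ⊆ker-metricOf a b eq = trans (normOf-metricOf-r a) (trans (cong (fromℕ ∘ (bound +_)) eq) (sym (normOf-metricOf-r b)))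

    inducedPartitions : List (Partition G)
    inducedPartitions = map (inducedPartition G ∘ metricOf) (setPartitions k)

    inducedPartitions-unique : Unique inducedPartitions
    inducedPartitions-unique = map-injectiveOn⁺ (inducedPartition G ∘ metricOf) injective (partitionsUpTo-unique k)
      where
      ⊆ker-of-≡ : ∀ {π ρ} →
        inducedPartition G (metricOf π) ≡ inducedPartition G (metricOf ρ) → lookup π ⊆ker lookup ρ
      ⊆ker-of-≡ {π} {ρ} eq a b =
        metricOf-⊆ker ρ a b
        ∘ inducedPartition-≡⇒⊆ker G {metricOf π} {metricOf ρ} eq (r a) (r b)
        ∘ ⊆ker-metricOf π a b
      injective : ∀ {π ρ} → π ∈ setPartitions k → ρ ∈ setPartitions k →
        inducedPartition G (metricOf π) ≡ inducedPartition G (metricOf ρ) → π ≡ ρ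
      injective π∈ ρ∈ eq = setPartitions-⊆ker-antisym k π∈ ρ∈ (⊆ker-of-≡ eq) (⊆ker-of-≡ (sym eq))

    ∈-inducedPartitions : ∀ {d} → IsBiInvariantMetric G d → inducedPartition G d ∈ inducedPartitions
    ∈-inducedPartitions {d} d-bi with setPartition-of _≟ℚ_ (normOf G d ∘ r)
    ... | π , π∈ , π⊆d , d⊆π = subst (_∈ inducedPartitions) same (∈-map⁺ (inducedPartition G ∘ metricOf) π∈)
      where
      same : inducedPartition G (metricOf π) ≡ inducedPartition G d
      same = inducedPartition-≡ G {metricOf π} {d}
        (normOf-⊆ker (metricOf-isBiInvariant π) d-bi (λ a b → π⊆d a b ∘ metricOf-⊆ker π a b))
        (normOf-⊆ker d-bi (metricOf-isBiInvariant π) (λ a b → ⊆ker-metricOf π a b ∘ d⊆π a b))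

    mStar : MStarIs G (bell k)
    mStar = inducedPartitions , inducedPartitions-unique , (λ P → mk⇔ (realized P) (realizable P)) ,
            trans (length-map (inducedPartition G ∘ metricOf) (setPartitions k)) (length-partitionsUpTo k)
      where
      realized : ∀ P → P ∈ inducedPartitions → ∃ λ d → IsBiInvariantMetric G d × inducedPartition G d ≡ P
      realized P P∈ with ∈-map⁻ (inducedPartition G ∘ metricOf) P∈
      ... | π , _ , refl = metricOf π , metricOf-isBiInvariant π , refl
      realizable : ∀ P → (∃ λ d → IsBiInvariantMetric G d × inducedPartition G d ≡ P) → P ∈ inducedPartitions
      realizable P (d , d-bi , refl) = ∈-inducedPartitions d-bi

proposition6p1 : (G : FinGroup) → MStarIs G (bell (kStar G))
proposition6p1 G = subst (MStarIs G ∘ bell) (sym kStar≡k)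
  (MStar.mStar G (subst (ClassEnumeration G) (length≡suc-pred (orbitRep-conjClass-∈ G e)) (classEnumeration G)))
  where
  open FinGroup G using (e)
  k : ℕ
  k = length (classes G) ∸ 1
  kStar≡k : kStar G ≡ k
  kStar≡k = trans (cong (λ m → m / 2 ∸ 1) (c+c₂≡length-classes*2 G)) (cong (_∸ 1) (m*n/n≡m (length (classes G)) 2))
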